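{- Let CCS$_f^-$ denote the set of CCS$_f$ terms not containing $\parallel$. For each CCS$_f$ term $t$ define $\hat t\in$ CCS$_f^-$ inductively by: - $\hat{\mathbf 0}=\mathbf 0$ and $\hat x=x$; - $\widehat{\mu.t}=\mu.\hat t$; - $\widehat{t+u}=\hat t+\hat u$; - $\widehat{f(t,u)}=f(\hat t,\hat u)$; - $\widehat{t\parallel u}=f(\hat t,\hat u)+f(\hat u,\hat t)$. For an axiom system $\mathcal E$ over CCS$_f$ let $\widehat{\mathcal E}=\{\hat t\approx\hat u\mid (t\approx u)\in\mathcal E\}$. Assume that the equation $x\parallel y\approx f(x,y)+f(y,x)$ is sound modulo bisimilarity. Then, for every axiom system $\mathcal E$ over CCS$_f$: (1) if $\mathcal E\vdash t\approx u$, then $\widehat{\mathcal E}\vdash\hat t\approx\hat u$; (2) if $\mathcal E$ is a complete axiomatisation of $\underline{\leftrightarrow}$ over CCS$_f$ (every equation $t\approx u$ between CCS$_f$ terms with $t\,\underline{\leftrightarrow}\,u$ is derivable from $\mathcal E$), then $\widehat{\mathcal E}$ completely axiomatises $\underline{\leftrightarrow}$ over CCS$_f^-$; (3) if bisimilarity is not finitely axiomatisable over CCS$_f^-$, then it is not finitely axiomatisable over CCS$_f$ either.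
   Context: Actions: $\mathcal A=\{a,\bar a,\tau\}$ with $a\ne\bar a$, $\bar{\bar a}=a$. CCS$_f$ terms: $t::=\mathbf 0\mid x\mid \mu.t\mid t+t\mid t\parallel t\mid f(t,t)$, with standard CCS semantics for prefixing, choice and parallel composition (interleaving plus $\tau$-synchronisation of $\beta$ with $\bar\beta$). The semantics of $f$ is given by rules in de Simone format: premises $\{x_i\xrightarrow{\mu_i}y_i\mid i\in I\}$ with $I\subseteq\{1,2\}$, conclusion $f(x_1,x_2)\xrightarrow{\mu}t$, pairwise distinct variables, and $t$ a term over $x_1,x_2,y_i$ with each variable at most once and no $x_i$ ($i\in I$). $\underline{\leftrightarrow}$ is strong bisimilarity on closed terms, extended to open terms via all closed substitutions; it is a congruence. $\mathcal E\vdash t\approx u$ denotes derivability in equational logic: reflexivity, symmetry, transitivity, substitution instances of axioms, and congruence for all operators of the language. Finitely axiomatisable means there exists a finite sound and complete axiom system. -}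

module Defs where

open import Data.Bool using (Bool; true; false; T)
open import Data.Unit using (⊤; tt)
open import Data.Empty using (⊥)
open import Data.Nat using (ℕ)
open import Data.Fin using (Fin)
open import Data.Maybe using (Maybe; just; nothing)
open import Data.List using (List; []; _∷_; _++_)
open import Data.List.Membership.Propositional using (_∈_)
open import Data.List.Relation.Unary.Unique.Propositional using (Unique)
open import Data.Product using (Σ; _×_; _,_; ∃; proj₁; proj₂)
open import Relation.Binary.PropositionalEquality using (_≡_)
open import Relation.Nullary using (¬_)

data Act : Set where
  a ā τ : Act

data Comp : Act → Act → Set where
  a-ā : Comp a ā
  ā-a : Comp ā a

-- Terms.  Term p V : terms over variables V; the parallel operator is
-- available only when T p holds.  Term true = CCS_f, Term false = CCS_f^-.

infixr 7 _·_
infixl 5 _+_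

data Term (p : Bool) (V : Set) : Set where
  𝟎   : Term p V
  var : V → Term p V
  _·_ : Act → Term p V → Term p V
  _+_ : Term p V → Term p V → Term p V
  par : T p → Term p V → Term p V → Term p V
  f   : Term p V → Term p V → Term p V

CCSf : Set → Set
CCSf = Term true

CCSf⁻ : Set → Set
CCSf⁻ = Term false

_∥_ : ∀ {V} → CCSf V → CCSf V → CCSf V
t ∥ u = par tt t u

sub : ∀ {p V W} → (V → Term p W) → Term p V → Term p W
sub σ 𝟎         = 𝟎
sub σ (var x)   = σ x
sub σ (μ · t)   = μ · sub σ t
sub σ (t + u)   = sub σ t + sub σ u
sub σ (par h t u) = par h (sub σ t) (sub σ u)
sub σ (f t u)   = f (sub σ t) (sub σ u)

vars : ∀ {p V} → Term p V → List V
vars 𝟎           = []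
vars (var x)     = x ∷ []
vars (μ · t)     = vars t
vars (t + u)     = vars t ++ vars u
vars (par _ t u) = vars t ++ vars u
vars (f t u)     = vars t ++ vars u

toCCSf : ∀ {p V} → Term p V → CCSf V
toCCSf 𝟎           = 𝟎
toCCSf (var x)     = var x
toCCSf (μ · t)     = μ · toCCSf t
toCCSf (t + u)     = toCCSf t + toCCSf u
toCCSf (par _ t u) = toCCSf t ∥ toCCSf u
toCCSf (f t u)     = f (toCCSf t) (toCCSf u)

hat : ∀ {V} → CCSf V → CCSf⁻ V
hat 𝟎           = 𝟎
hat (var x)     = var x
hat (μ · t)     = μ · hat t
hat (t + u)     = hat t + hat u
hat (par _ t u) = f (hat t) (hat u) + f (hat u) (hat t)
hat (f t u)     = f (hat t) (hat u)

-- de Simone rules for the binary operator f.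
-- A rule has premises  x_i -μ_i-> y_i  for i ∈ I ⊆ {1,2}
-- (prem i = just μ_i  iff  i ∈ I), conclusion label act, and target
-- term over the variables Fin 2, where variable i stands for y_i if
-- i ∈ I and for x_i otherwise (so x_i, i ∈ I, cannot occur, and only the
-- y_i with i ∈ I are available).

record Rule : Set where
  field
    prem1  : Maybe Act
    prem2  : Maybe Act
    act    : Act
    target : CCSf (Fin 2)
    linear : Unique (vars target)

open Rule public

module Semantics (R : Rule → Set) where

  Closed : Set
  Closed = CCSf ⊥

  mutual
    data _—_⟶_ : Closed → Act → Closed → Set where
      pre   : ∀ {μ t} → (μ · t) — μ ⟶ t
      sumL  : ∀ {t u μ t'} → t — μ ⟶ t' → (t + u) — μ ⟶ t'
      sumR  : ∀ {t u μ u'} → u — μ ⟶ u' → (t + u) — μ ⟶ u'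
      parL  : ∀ {t u μ t'} → t — μ ⟶ t' → (t ∥ u) — μ ⟶ (t' ∥ u)
      parR  : ∀ {t u μ u'} → u — μ ⟶ u' → (t ∥ u) — μ ⟶ (t ∥ u')
      sync  : ∀ {t u t' u' β γ} → Comp β γ → t — β ⟶ t' → u — γ ⟶ u' →
              (t ∥ u) — τ ⟶ (t' ∥ u')
      frule : ∀ {t₁ t₂ s₁ s₂} (r : Rule) → R r →
              Step (prem1 r) t₁ s₁ → Step (prem2 r) t₂ s₂ →
              f t₁ t₂ — act r ⟶ sub (args s₁ s₂) (target r)

    data Step : Maybe Act → Closed → Closed → Set where
      stay : ∀ {t} → Step nothing t t
      move : ∀ {μ t s} → t — μ ⟶ s → Step (just μ) t s

    args : Closed → Closed → Fin 2 → Closed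
    args s₁ s₂ Fin.zero = s₁
    args s₁ s₂ (Fin.suc _) = s₂

  record IsBisimulation (Rel : Closed → Closed → Set) : Set where
    field
      forth : ∀ {t u μ t'} → Rel t u → t — μ ⟶ t' →
              ∃ λ u' → (u — μ ⟶ u') × Rel t' u'
      back  : ∀ {t u μ u'} → Rel t u → u — μ ⟶ u' →
              ∃ λ t' → (t — μ ⟶ t') × Rel t' u'

  _↔_ : Closed → Closed → Set₁
  t ↔ u = Σ (Closed → Closed → Set) λ Rel → IsBisimulation Rel × Rel t u

  _↔ₒ_ : ∀ {p} → Term p ℕ → Term p ℕ → Set₁
  _↔ₒ_ {p} t u = (σ : ℕ → Term p ⊥) →
    toCCSf (sub σ t) ↔ toCCSf (sub σ u)

Eqn : Bool → Set
Eqn p = Term p ℕ × Term p ℕ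

Axioms : Bool → Set₁
Axioms p = Eqn p → Set

data _⊢_≈_ {p : Bool} (E : Axioms p) : Term p ℕ → Term p ℕ → Set where
  refl  : ∀ {t} → E ⊢ t ≈ t
  sym   : ∀ {t u} → E ⊢ t ≈ u → E ⊢ u ≈ t
  trans : ∀ {t u v} → E ⊢ t ≈ u → E ⊢ u ≈ v → E ⊢ t ≈ v
  ax    : ∀ {t u} → E (t , u) → (σ : ℕ → Term p ℕ) → E ⊢ sub σ t ≈ sub σ u
  cpre  : ∀ {μ t u} → E ⊢ t ≈ u → E ⊢ (μ · t) ≈ (μ · u)
  csum  : ∀ {t t' u u'} → E ⊢ t ≈ t' → E ⊢ u ≈ u' → E ⊢ (t + u) ≈ (t' + u')
  cpar  : ∀ {t t' u u'} (h : T p) → E ⊢ t ≈ t' → E ⊢ u ≈ u' →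
          E ⊢ par h t u ≈ par h t' u'
  cf    : ∀ {t t' u u'} → E ⊢ t ≈ t' → E ⊢ u ≈ u' → E ⊢ f t u ≈ f t' u'

hatAx : Axioms true → Axioms false
hatAx E (t' , u') = Σ (Eqn true) λ e →
  E e × (t' ≡ hat (proj₁ e)) × (u' ≡ hat (proj₂ e))

module Axiomatisation (R : Rule → Set) where
  open Semantics R

  Sound : ∀ {p} → Axioms p → Set₁
  Sound E = ∀ t u → E (t , u) → t ↔ₒ u

  Complete : ∀ {p} → Axioms p → Set₁
  Complete E = ∀ t u → t ↔ₒ u → E ⊢ t ≈ u

  FinitelyAxiomatisable : Bool → Set₁
  FinitelyAxiomatisable p = Σ (List (Eqn p)) λ E →
    Sound (λ e → e ∈ E) × Complete (λ e → e ∈ E)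

-- The translation commutes with substitution and maps the congruence rule of ∥
-- to those of + and f, so it carries E-derivations to Ê-derivations.  Because
-- bisimilarity is a congruence (the rules of f are in de Simone format), the law
-- x ∥ y ≈ f(x,y) + f(y,x) gives p ↔ p̂ for every closed p by induction on p.
-- Hence t ↔ u implies t̂ ↔ û, and a CCS_f^- equation that holds over CCS_f^-
-- also holds over CCS_f.  So if E is complete, a valid CCS_f^- equation t ≈ u
-- is derivable from E, and its translation, which is t ≈ u itself, from Ê;
-- for finite E the finite set Ê is moreover sound.

module Submission where

open import Defs
open import Data.Bool using (true; false)
open import Data.Fin using (Fin)
open import Data.List using (map)
open import Data.List.Membership.Propositional using (_∈_)
open import Data.List.Membership.Propositional.Properties using (∈-map⁺; ∈-map⁻)
open import Data.Nat using (ℕ; zero; suc)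
open import Data.Product using (_×_; _,_; ∃)
open import Data.Sum using (_⊎_; inj₁; inj₂)
open import Data.Unit using (tt)
open import Function using (_∘_; flip)
open import Level using (0ℓ) renaming (suc to lsuc)
open import Relation.Binary.Bundles using (Setoid)
open import Relation.Nullary using (¬_)
open import Relation.Binary.PropositionalEquality as ≡ using (_≡_; cong; cong₂; subst₂)

sub-cong : ∀ {p V W} {σ ρ : V → Term p W} → (∀ x → σ x ≡ ρ x) →
           ∀ t → sub σ t ≡ sub ρ t
sub-cong σ≡ρ 𝟎           = ≡.refl
sub-cong σ≡ρ (var x)     = σ≡ρ x
sub-cong σ≡ρ (μ · t)     = cong (μ ·_) (sub-cong σ≡ρ t)
sub-cong σ≡ρ (t + u)     = cong₂ _+_ (sub-cong σ≡ρ t) (sub-cong σ≡ρ u)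
sub-cong σ≡ρ (par h t u) = cong₂ (par h) (sub-cong σ≡ρ t) (sub-cong σ≡ρ u)
sub-cong σ≡ρ (f t u)     = cong₂ f (sub-cong σ≡ρ t) (sub-cong σ≡ρ u)

hat-sub : ∀ {V W} (σ : V → CCSf W) t → hat (sub σ t) ≡ sub (hat ∘ σ) (hat t)
hat-sub σ 𝟎           = ≡.refl
hat-sub σ (var x)     = ≡.refl
hat-sub σ (μ · t)     = cong (μ ·_) (hat-sub σ t)
hat-sub σ (t + u)     = cong₂ _+_ (hat-sub σ t) (hat-sub σ u)
hat-sub σ (par _ t u) = cong₂ (λ t' u' → f t' u' + f u' t') (hat-sub σ t) (hat-sub σ u)
hat-sub σ (f t u)     = cong₂ f (hat-sub σ t) (hat-sub σ u)

hat-toCCSf : ∀ {V} (t : CCSf⁻ V) → hat (toCCSf t) ≡ t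
hat-toCCSf 𝟎           = ≡.refl
hat-toCCSf (var x)     = ≡.refl
hat-toCCSf (μ · t)     = cong (μ ·_) (hat-toCCSf t)
hat-toCCSf (t + u)     = cong₂ _+_ (hat-toCCSf t) (hat-toCCSf u)
hat-toCCSf (par () t u)
hat-toCCSf (f t u)     = cong₂ f (hat-toCCSf t) (hat-toCCSf u)

toCCSf-id : ∀ {V} (t : CCSf V) → toCCSf t ≡ t
toCCSf-id 𝟎            = ≡.refl
toCCSf-id (var x)      = ≡.refl
toCCSf-id (μ · t)      = cong (μ ·_) (toCCSf-id t)
toCCSf-id (t + u)      = cong₂ _+_ (toCCSf-id t) (toCCSf-id u)
toCCSf-id (par tt t u) = cong₂ _∥_ (toCCSf-id t) (toCCSf-id u)
toCCSf-id (f t u)      = cong₂ f (toCCSf-id t) (toCCSf-id u)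

⊢-mono : ∀ {p} {E E' : Axioms p} → (∀ {e} → E e → E' e) →
         ∀ {t u} → E ⊢ t ≈ u → E' ⊢ t ≈ u
⊢-mono E⊆E' refl          = refl
⊢-mono E⊆E' (sym d)       = sym (⊢-mono E⊆E' d)
⊢-mono E⊆E' (trans d d')  = trans (⊢-mono E⊆E' d) (⊢-mono E⊆E' d')
⊢-mono E⊆E' (ax e σ)      = ax (E⊆E' e) σ
⊢-mono E⊆E' (cpre d)      = cpre (⊢-mono E⊆E' d)
⊢-mono E⊆E' (csum d d')   = csum (⊢-mono E⊆E' d) (⊢-mono E⊆E' d')
⊢-mono E⊆E' (cpar h d d') = cpar h (⊢-mono E⊆E' d) (⊢-mono E⊆E' d')
⊢-mono E⊆E' (cf d d')     = cf (⊢-mono E⊆E' d) (⊢-mono E⊆E' d')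

hat-⊢ : ∀ {E : Axioms true} {t u} → E ⊢ t ≈ u → hatAx E ⊢ hat t ≈ hat u
hat-⊢ refl          = refl
hat-⊢ (sym d)       = sym (hat-⊢ d)
hat-⊢ (trans d d')  = trans (hat-⊢ d) (hat-⊢ d')
hat-⊢ {E} (ax {t} {u} e σ) =
  subst₂ (hatAx E ⊢_≈_) (≡.sym (hat-sub σ t)) (≡.sym (hat-sub σ u))
    (ax ((t , u) , e , ≡.refl , ≡.refl) (hat ∘ σ))
hat-⊢ (cpre d)      = cpre (hat-⊢ d)
hat-⊢ (csum d d')   = csum (hat-⊢ d) (hat-⊢ d')
hat-⊢ (cpar _ d d') = csum (cf (hat-⊢ d) (hat-⊢ d')) (cf (hat-⊢ d') (hat-⊢ d))
hat-⊢ (cf d d')     = cf (hat-⊢ d) (hat-⊢ d')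

module Bisimilarity (R : Rule → Set) where
  open Semantics R
  open IsBisimulation

  ≡-isBisimulation : IsBisimulation _≡_
  forth ≡-isBisimulation ≡.refl tr = _ , tr , ≡.refl
  back  ≡-isBisimulation ≡.refl tr = _ , tr , ≡.refl

  flip-isBisimulation : ∀ {B} → IsBisimulation B → IsBisimulation (flip B)
  forth (flip-isBisimulation isB) = back isB
  back  (flip-isBisimulation isB) = forth isB

  ∘-isBisimulation : ∀ {B₁ B₂} → IsBisimulation B₁ → IsBisimulation B₂ →
                     IsBisimulation (λ p r → ∃ λ q → B₁ p q × B₂ q r)
  forth (∘-isBisimulation isB₁ isB₂) (q , pB₁q , qB₂r) tr
    with forth isB₁ pB₁q tr
  ... | q' , tr₁ , p'B₁q' with forth isB₂ qB₂r tr₁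
  ... | r' , tr₂ , q'B₂r' = r' , tr₂ , (q' , p'B₁q' , q'B₂r')
  back (∘-isBisimulation isB₁ isB₂) (q , pB₁q , qB₂r) tr
    with back isB₂ qB₂r tr
  ... | q' , tr₁ , q'B₂r' with back isB₁ pB₁q tr₁
  ... | p' , tr₂ , p'B₁q' = p' , tr₂ , (q' , p'B₁q' , q'B₂r')

  ⊎-isBisimulation : ∀ {B₁ B₂} → IsBisimulation B₁ → IsBisimulation B₂ →
                     IsBisimulation (λ p q → B₁ p q ⊎ B₂ p q)
  forth (⊎-isBisimulation isB₁ isB₂) (inj₁ pBq) tr with forth isB₁ pBq tr
  ... | q' , tr' , p'Bq' = q' , tr' , inj₁ p'Bq'
  forth (⊎-isBisimulation isB₁ isB₂) (inj₂ pBq) tr with forth isB₂ pBq tr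
  ... | q' , tr' , p'Bq' = q' , tr' , inj₂ p'Bq'
  back (⊎-isBisimulation isB₁ isB₂) (inj₁ pBq) tr with back isB₁ pBq tr
  ... | p' , tr' , p'Bq' = p' , tr' , inj₁ p'Bq'
  back (⊎-isBisimulation isB₁ isB₂) (inj₂ pBq) tr with back isB₂ pBq tr
  ... | p' , tr' , p'Bq' = p' , tr' , inj₂ p'Bq'

  ↔-setoid : Setoid 0ℓ (lsuc 0ℓ)
  ↔-setoid = record
    { Carrier       = Closed
    ; _≈_           = _↔_
    ; isEquivalence = record
      { refl  = _ , ≡-isBisimulation , ≡.refl
      ; sym   = λ (B , isB , pBq) → flip B , flip-isBisimulation isB , pBq
      ; trans = λ (_ , isB₁ , pB₁q) (_ , isB₂ , qB₂r) →
                  _ , ∘-isBisimulation isB₁ isB₂ , (_ , pB₁q , qB₂r)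
      }
    }

  data Closure (B : Closed → Closed → Set) : Closed → Closed → Set where
    base : ∀ {p q} → B p q → Closure B p q
    nil  : Closure B 𝟎 𝟎
    pre  : ∀ {μ p q} → Closure B p q → Closure B (μ · p) (μ · q)
    sum  : ∀ {p p' q q'} → Closure B p p' → Closure B q q' →
           Closure B (p + q) (p' + q')
    par  : ∀ {p p' q q'} → Closure B p p' → Closure B q q' →
           Closure B (p ∥ q) (p' ∥ q')
    app  : ∀ {p p' q q'} → Closure B p p' → Closure B q q' →
           Closure B (f p q) (f p' q')

  closure-sub : ∀ {B} {σ ρ : Fin 2 → Closed} → (∀ i → Closure B (σ i) (ρ i)) →
                ∀ t → Closure B (sub σ t) (sub ρ t)
  closure-sub σBρ 𝟎            = nil
  closure-sub σBρ (var i)      = σBρ i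
  closure-sub σBρ (μ · t)      = pre (closure-sub σBρ t)
  closure-sub σBρ (t + u)      = sum (closure-sub σBρ t) (closure-sub σBρ u)
  closure-sub σBρ (par tt t u) = par (closure-sub σBρ t) (closure-sub σBρ u)
  closure-sub σBρ (f t u)      = app (closure-sub σBρ t) (closure-sub σBρ u)

  closure-args : ∀ {B p₁ p₂ q₁ q₂} → Closure B p₁ q₁ → Closure B p₂ q₂ →
                 ∀ i → Closure B (args p₁ p₂ i) (args q₁ q₂ i)
  closure-args p₁Bq₁ p₂Bq₂ Fin.zero    = p₁Bq₁
  closure-args p₁Bq₁ p₂Bq₂ (Fin.suc _) = p₂Bq₂

  module _ {B : Closed → Closed → Set} (isB : IsBisimulation B) where
    mutual
      closure-forth : ∀ {p q μ p'} → Closure B p q → p — μ ⟶ p' →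
                      ∃ λ q' → (q — μ ⟶ q') × Closure B p' q'
      closure-forth (base pBq) tr with forth isB pBq tr
      ... | q' , tr' , p'Bq' = q' , tr' , base p'Bq'
      closure-forth nil ()
      closure-forth (pre pBq) pre = _ , pre , pBq
      closure-forth (sum pBq _) (sumL tr) with closure-forth pBq tr
      ... | q' , tr' , p'Bq' = q' , sumL tr' , p'Bq'
      closure-forth (sum _ pBq) (sumR tr) with closure-forth pBq tr
      ... | q' , tr' , p'Bq' = q' , sumR tr' , p'Bq'
      closure-forth (par p₁Bq₁ p₂Bq₂) (parL tr) with closure-forth p₁Bq₁ tr
      ... | _ , tr' , p₁'Bq₁' = _ , parL tr' , par p₁'Bq₁' p₂Bq₂
      closure-forth (par p₁Bq₁ p₂Bq₂) (parR tr) with closure-forth p₂Bq₂ tr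
      ... | _ , tr' , p₂'Bq₂' = _ , parR tr' , par p₁Bq₁ p₂'Bq₂'
      closure-forth (par p₁Bq₁ p₂Bq₂) (sync c tr₁ tr₂)
        with closure-forth p₁Bq₁ tr₁ | closure-forth p₂Bq₂ tr₂
      ... | _ , tr₁' , p₁'Bq₁' | _ , tr₂' , p₂'Bq₂' =
        _ , sync c tr₁' tr₂' , par p₁'Bq₁' p₂'Bq₂'
      closure-forth (app p₁Bq₁ p₂Bq₂) (frule r r∈R st₁ st₂)
        with closure-step p₁Bq₁ st₁ | closure-step p₂Bq₂ st₂
      ... | _ , st₁' , s₁Bs₁' | _ , st₂' , s₂Bs₂' =
        _ , frule r r∈R st₁' st₂' ,
        closure-sub (closure-args s₁Bs₁' s₂Bs₂') (target r)

      closure-step : ∀ {m p q s} → Closure B p q → Step m p s →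
                     ∃ λ s' → Step m q s' × Closure B s s'
      closure-step pBq stay = _ , stay , pBq
      closure-step pBq (move tr) with closure-forth pBq tr
      ... | q' , tr' , p'Bq' = q' , move tr' , p'Bq'

  closure-flip : ∀ {B p q} → Closure B p q → Closure (flip B) q p
  closure-flip (base pBq)  = base pBq
  closure-flip nil         = nil
  closure-flip (pre c)     = pre (closure-flip c)
  closure-flip (sum c c')  = sum (closure-flip c) (closure-flip c')
  closure-flip (par c c')  = par (closure-flip c) (closure-flip c')
  closure-flip (app c c')  = app (closure-flip c) (closure-flip c')

  closure-isBisimulation : ∀ {B} → IsBisimulation B → IsBisimulation (Closure B)
  forth (closure-isBisimulation isB) = closure-forth isB
  back  (closure-isBisimulation isB) pBq tr
    with closure-forth (flip-isBisimulation isB) (closure-flip pBq) tr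
  ... | p' , tr' , q'Bp' = p' , tr' , closure-flip q'Bp'

  ↔-pre : ∀ {μ p q} → p ↔ q → (μ · p) ↔ (μ · q)
  ↔-pre (_ , isB , pBq) = _ , closure-isBisimulation isB , pre (base pBq)

  ↔-sum : ∀ {p p' q q'} → p ↔ p' → q ↔ q' → (p + q) ↔ (p' + q')
  ↔-sum (_ , isB₁ , pB₁p') (_ , isB₂ , qB₂q') =
    _ , closure-isBisimulation (⊎-isBisimulation isB₁ isB₂) ,
    sum (base (inj₁ pB₁p')) (base (inj₂ qB₂q'))

  ↔-f : ∀ {p p' q q'} → p ↔ p' → q ↔ q' → f p q ↔ f p' q'
  ↔-f (_ , isB₁ , pB₁p') (_ , isB₂ , qB₂q') =
    _ , closure-isBisimulation (⊎-isBisimulation isB₁ isB₂) ,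
    app (base (inj₁ pB₁p')) (base (inj₂ qB₂q'))

module ParallelElimination
  (R : Rule → Set)
  (∥-expansion : Semantics._↔ₒ_ R {true}
                   (var 0 ∥ var 1) (f (var 0) (var 1) + f (var 1) (var 0)))
  where
  open Semantics R
  open Axiomatisation R
  open Bisimilarity R
  open Setoid ↔-setoid using () renaming (refl to ↔-refl; sym to ↔-sym)
  open import Relation.Binary.Reasoning.Setoid ↔-setoid

  ∥-expansion-closed : ∀ p q → (p ∥ q) ↔ (f p q + f q p)
  ∥-expansion-closed p q =
    subst₂ _↔_ (cong₂ _∥_ (toCCSf-id p) (toCCSf-id q))
      (cong₂ (λ p' q' → f p' q' + f q' p') (toCCSf-id p) (toCCSf-id q))
      (∥-expansion σ)
    where
      σ : ℕ → Closed
      σ zero          = p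
      σ (suc zero)    = q
      σ (suc (suc _)) = 𝟎

  ↔-hat : ∀ p → p ↔ toCCSf (hat p)
  ↔-hat 𝟎            = ↔-refl
  ↔-hat (var ())
  ↔-hat (μ · p)      = ↔-pre (↔-hat p)
  ↔-hat (p + q)      = ↔-sum (↔-hat p) (↔-hat q)
  ↔-hat (par tt p q) = begin
    p ∥ q          ≈⟨ ∥-expansion-closed p q ⟩
    f p q + f q p  ≈⟨ ↔-sum (↔-f (↔-hat p) (↔-hat q)) (↔-f (↔-hat q) (↔-hat p)) ⟩
    toCCSf (hat (p ∥ q))  ∎
  ↔-hat (f p q)      = ↔-f (↔-hat p) (↔-hat q)

  sub-↔-hat : ∀ (σ : ℕ → Closed) t → sub σ t ↔ toCCSf (sub (hat ∘ σ) (hat t))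
  sub-↔-hat σ t = begin
    sub σ t                          ≈⟨ ↔-hat (sub σ t) ⟩
    toCCSf (hat (sub σ t))           ≡⟨ cong toCCSf (hat-sub σ t) ⟩
    toCCSf (sub (hat ∘ σ) (hat t))   ∎

  hat-↔ₒ : ∀ (t u : CCSf ℕ) → t ↔ₒ u → hat t ↔ₒ hat u
  hat-↔ₒ t u t↔u σ = begin
    toCCSf (sub σ (hat t))        ≈⟨ instance-↔ t ⟩
    toCCSf (sub (toCCSf ∘ σ) t)   ≈⟨ t↔u (toCCSf ∘ σ) ⟩
    toCCSf (sub (toCCSf ∘ σ) u)   ≈⟨ instance-↔ u ⟨
    toCCSf (sub σ (hat u))        ∎
    where
      instance-↔ : ∀ v → toCCSf (sub σ (hat v)) ↔ toCCSf (sub (toCCSf ∘ σ) v)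
      instance-↔ v = ↔-sym (begin
        toCCSf (sub (toCCSf ∘ σ) v)              ≡⟨ toCCSf-id _ ⟩
        sub (toCCSf ∘ σ) v                       ≈⟨ sub-↔-hat (toCCSf ∘ σ) v ⟩
        toCCSf (sub (hat ∘ toCCSf ∘ σ) (hat v))  ≡⟨ cong toCCSf (sub-cong (hat-toCCSf ∘ σ) (hat v)) ⟩
        toCCSf (sub σ (hat v))                   ∎)

  toCCSf-↔ₒ : ∀ (t u : CCSf⁻ ℕ) → t ↔ₒ u → toCCSf t ↔ₒ toCCSf u
  toCCSf-↔ₒ t u t↔u σ = begin
    toCCSf (sub σ (toCCSf t))   ≈⟨ instance-↔ t ⟩
    toCCSf (sub (hat ∘ σ) t)    ≈⟨ t↔u (hat ∘ σ) ⟩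
    toCCSf (sub (hat ∘ σ) u)    ≈⟨ instance-↔ u ⟨
    toCCSf (sub σ (toCCSf u))   ∎
    where
      instance-↔ : ∀ v → toCCSf (sub σ (toCCSf v)) ↔ toCCSf (sub (hat ∘ σ) v)
      instance-↔ v = begin
        toCCSf (sub σ (toCCSf v))                  ≡⟨ toCCSf-id _ ⟩
        sub σ (toCCSf v)                           ≈⟨ sub-↔-hat σ (toCCSf v) ⟩
        toCCSf (sub (hat ∘ σ) (hat (toCCSf v)))    ≡⟨ cong (toCCSf ∘ sub (hat ∘ σ)) (hat-toCCSf v) ⟩
        toCCSf (sub (hat ∘ σ) v)                   ∎

  hatAx-complete : ∀ (E : Axioms true) → Complete E → Complete (hatAx E)
  hatAx-complete E complete t u t↔u =
    subst₂ (hatAx E ⊢_≈_) (hat-toCCSf t) (hat-toCCSf u)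
      (hat-⊢ (complete (toCCSf t) (toCCSf u) (toCCSf-↔ₒ t u t↔u)))

  hatEq : Eqn true → Eqn false
  hatEq (t , u) = hat t , hat u

  finitelyAxiomatisable-hat : FinitelyAxiomatisable true → FinitelyAxiomatisable false
  finitelyAxiomatisable-hat (E , sound , complete) = map hatEq E , sound⁻ , complete⁻
    where
      sound⁻ : Sound (_∈ map hatEq E)
      sound⁻ _ _ e∈Ê with ∈-map⁻ hatEq e∈Ê
      ... | (t , u) , e∈E , ≡.refl = hat-↔ₒ t u (sound t u e∈E)

      hatAx⊆map : ∀ {e} → hatAx (_∈ E) e → e ∈ map hatEq E
      hatAx⊆map (_ , e∈E , ≡.refl , ≡.refl) = ∈-map⁺ hatEq e∈E

      complete⁻ : Complete (_∈ map hatEq E)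
      complete⁻ t u t↔u = ⊢-mono hatAx⊆map (hatAx-complete (_∈ E) complete t u t↔u)

proposition5 : (R : Rule → Set) →
    let open Semantics R
        open Axiomatisation R
    in _↔ₒ_ {true} (var 0 ∥ var 1) (f (var 0) (var 1) + f (var 1) (var 0)) →
       ((E : Axioms true) →
          (∀ (t u : CCSf ℕ) → E ⊢ t ≈ u → hatAx E ⊢ hat t ≈ hat u)
        × (Complete E → Complete (hatAx E)))
       × (¬ FinitelyAxiomatisable false → ¬ FinitelyAxiomatisable true)
proposition5 R ∥-expansion =
  (λ E → (λ _ _ → hat-⊢) , hatAx-complete E) ,
  λ ¬fa⁻ → ¬fa⁻ ∘ finitelyAxiomatisable-hat
  where open ParallelElimination R ∥-expansion
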